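{- Let $\mathcal{Q}=(N,\mathcal{M})$ be an abstract questionnaire with flag-set $F$ and skip-list $\mathcal{S}$, and let $T$ be its FS-decision tree, with set of skipped vertices $U$, question assignment $\kappa$ and answer string assignment $\alpha$. Let $v,w$ be vertices of $T$ with $\kappa(v)=\kappa(w)=k$, let $T_v,T_w$ be the subtrees of $T$ rooted at $v$ and $w$, and let $\Phi:V(T_v)\to V(T_w)$ be a bijection such that for every $u\in V(T_v)$: if $\alpha(u)=\alpha(v)x$, where $x=\epsilon$ or $x$ is a $(k,\kappa(u)-1)$-answer string, then $\alpha(\Phi(u))=\alpha(w)x$. Then: (i) $\Phi(v)=w$; (ii) $\kappa(\Phi(u))=\kappa(u)$ for all $u\in V(T_v)$; (iii) $\Phi$ is the unique bijection $V(T_v)\to V(T_w)$ with the stated property; (iv) $\Phi$ is an isomorphism from $T_v$ to $T_w$; (v) for every $u\in V(T_v)$ with $\kappa(u)\le N-1$ and $m_{\kappa(u)}\ge 2$, we have $u\in U$ if and only if $\Phi(u)\in U$.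
   Context: An abstract questionnaire is a pair $(N,\mathcal{M})$ with $N$ a positive integer and $\mathcal{M}=(m_0,\ldots,m_{N-1})$ a tuple of positive integers. Put $A_i=\{0,1,\ldots,m_i-1\}$ and $A_i^*=A_i\cup\{*\}$, where $*$ is a new symbol. For $0\le k\le \ell\le N-1$, a $(k,\ell)$-answer string is a string $a_k\ldots a_\ell$ with $a_i\in A_i^*$; $\epsilon$ is the empty string; juxtaposition is concatenation. A flag-set is a set of $(0,N-1)$-answer strings (it plays no role in this statement). A skip-list is an $(N+1)$-tuple $(S_0,\ldots,S_N)$ such that: $S_0=S_N=\emptyset$; for $1\le q\le N$, $S_q$ is a set of $(0,q-1)$-answer strings; and for each $q$ with $1 \le q\le N-1$ and each $(0,q-1)$-answer string $a$: if $a\in S_q$, then for every $j\in A_q$, $aj\notin S_{q+1}$ and $ajb\notin S_{k+1}$ for all $q+1\le k\le N-1$ and $b\in A_{q+1}^*\times\cdots\times A_k^*$; if $a\notin S_q$, then $a*\notin S_{q+1}$ and $a*b\notin S_{k+1}$ for all such $k,b$. The FS-decision tree $T$ is the ordered rooted tree, with set $U$ of skipped vertices, question assignment $\kappa$ and answer string assignment $\alpha$, defined recursively: the root $r$ has $\kappa(r)=0$, $\alpha(r)=\epsilon$; a vertex $u$ with $\kappa(u)=q\le N$ lies in $U$ iff $\alpha(u)\in S_q$; if $\kappa(u)=q<N$ and $u\in U$, $u$ has exactly one child $c$, with $\kappa(c)=q+1$, $\alpha(c)=\alpha(u)*$; if $\kappa(u)=q<N$ and $u\notin U$, $u$ has exactly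 $m_q$ children, the $j$-th ($j\in A_q$) child $c$ having $\kappa(c)=q+1$, $\alpha(c)=\alpha(u)j$; vertices with $\kappa=N$ have no children. The subtree rooted at $v$ is the subgraph induced by $v$ and all its descendants (with the root $v$ and inherited child orderings). -}

module Defs where

open import Data.Nat using (ℕ; zero; suc; _≤_; _<_)
open import Data.Fin using (Fin; toℕ)
open import Data.Maybe using (Maybe; just; nothing)
open import Data.Bool using (Bool; true; false)
open import Data.Product using (Σ; _×_; _,_)
open import Relation.Binary.PropositionalEquality using (_≡_)
open import Function.Bundles using (_⇔_)
open import Function.Definitions using (Bijective)

-- An abstract questionnaire (N, (m_0,...,m_{N-1})).
-- The tuple is given as a function ℕ → ℕ; only the values m i with i < N
-- are ever used (answer strings never reach positions ≥ N).
record Questionnaire : Set where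
  field
    N     : ℕ
    N-pos : 1 ≤ N
    m     : ℕ → ℕ
    m-pos : ∀ i → i < N → 1 ≤ m i

module Strings (m : ℕ → ℕ) where

  -- A_i^* = A_i ∪ {*}; nothing plays the role of *.
  Ans : ℕ → Set
  Ans i = Maybe (Fin (m i))

  -- Str k l : answer strings a_k a_{k+1} ... a_{l-1} with a_i ∈ A_i^*.
  -- So a (k,l)-answer string of the paper is an element of Str k (suc l),
  -- and Str k k contains only the empty string ε.
  data Str (k : ℕ) : ℕ → Set where
    ε   : Str k k
    _▷_ : ∀ {l} → Str k l → Ans l → Str k (suc l)

  infixl 5 _▷_
  infixr 4 _++_

  _++_ : ∀ {j k l} → Str j k → Str k l → Str j l
  a ++ ε       = a
  a ++ (b ▷ x) = (a ++ b) ▷ x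

module _ (Q : Questionnaire) where
  open Questionnaire Q
  open Strings m

  -- a flag-set: a set of (0,N-1)-answer strings (plays no role)
  FlagSet : Set
  FlagSet = Str 0 N → Bool

  -- skip-list (S_0,...,S_N); S q is the characteristic function of S_q
  -- (values for q > N are irrelevant and unused).
  record SkipList : Set where
    field
      S  : (q : ℕ) → Str 0 q → Bool
      S₀ : ∀ a → S 0 a ≡ false
      Sₙ : ∀ a → S N a ≡ false
      skip-in : ∀ q → 1 ≤ q → q < N → (a : Str 0 q) → S q a ≡ true →
        (j : Fin (m q)) →
          S (suc q) (a ▷ just j) ≡ false
          × (∀ k → suc q ≤ k → k < N → (b : Str (suc q) (suc k)) →
               S (suc k) ((a ▷ just j) ++ b) ≡ false)
      skip-out : ∀ q → 1 ≤ q → q < N → (a : Str 0 q) → S q a ≡ false →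
          S (suc q) (a ▷ nothing) ≡ false
          × (∀ k → suc q ≤ k → k < N → (b : Str (suc q) (suc k)) →
               S (suc k) ((a ▷ nothing) ++ b) ≡ false)

-- A vertex u with κ(u) = q is represented by its
-- answer string α(u) : Str 0 q together with an (irrelevant) proof that it
-- is generated by the recursive construction of the tree; α is injective on
-- vertices, so this is a concrete presentation of T.
module FSTree (Q : Questionnaire) (SL : SkipList Q) where
  open Questionnaire Q
  open Strings m
  open SkipList SL

  data IsV : (q : ℕ) → Str 0 q → Set where
    rootV : IsV 0 ε
    skipV : ∀ {q a} → IsV q a → q < N → S q a ≡ true → IsV (suc q) (a ▷ nothing)
    ansV  : ∀ {q a} → IsV q a → q < N → S q a ≡ false → (j : Fin (m q)) →
            IsV (suc q) (a ▷ just j)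

  record Vert (q : ℕ) : Set where
    constructor vert
    field
      α   : Str 0 q
      .isV : IsV q α
  open Vert public

  root : Vert 0
  root = vert ε rootV

  Skipped : ∀ {q} → Vert q → Set
  Skipped {q} u = S q (α u) ≡ true

  -- ChildAt u i c : c is the i-th child (0-based) of u in the ordered tree
  data ChildAt : ∀ {p q} → Vert p → ℕ → Vert q → Set where
    skipC : ∀ {p} {u : Vert p} {c : Vert (suc p)} →
            S p (α u) ≡ true → α c ≡ (α u ▷ nothing) → ChildAt u 0 c
    ansC  : ∀ {p} {u : Vert p} {c : Vert (suc p)} (j : Fin (m p)) →
            S p (α u) ≡ false → α c ≡ (α u ▷ just j) → ChildAt u (toℕ j) c

  data Desc {k} (v : Vert k) : ∀ {l} → Vert l → Set where
    here : Desc v v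
    step : ∀ {l l'} {u : Vert l} {c : Vert l'} {i} →
           Desc v u → ChildAt u i c → Desc v c

  record Sub {k} (v : Vert k) : Set where
    constructor sub
    field
      κ    : ℕ
      vx   : Vert κ
      .desc : Desc v vx
  open Sub public

  top : ∀ {k} (v : Vert k) → Sub v
  top {k} v = sub k v here

  -- the hypothesis on Φ : for u ∈ V(T_v), if α(u) = α(v)x (x a (k,κ(u)-1)-
  -- answer string or ε) then α(Φ u) = α(w)x  (equality of strings, which
  -- includes equality of lengths).
  StrProp : ∀ {k} (v w : Vert k) → (Sub v → Sub w) → Set
  StrProp {k} v w Φ =
    ∀ (u : Sub v) (x : Str k (κ u)) → α (vx u) ≡ (α v ++ x) →
      _≡_ {A = Σ ℕ (Str 0)} (κ (Φ u) , α (vx (Φ u))) (κ u , (α w ++ x))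

  IsOrdIso : ∀ {k} (v w : Vert k) → (Sub v → Sub w) → Set
  IsOrdIso v w Φ =
    Bijective _≡_ _≡_ Φ
    × Φ (top v) ≡ top w
    × (∀ (u c : Sub v) (i : ℕ) →
         ChildAt (vx u) i (vx c) ⇔ ChildAt (vx (Φ u)) i (vx (Φ c)))

-- Every vertex u of T_v has answer string α(v) x for a unique suffix x, and the
-- hypothesis forces α(Φ u) = α(w) x with κ(Φ u) = κ(u).  Since a vertex is
-- determined by its answer string, this pins Φ down, giving (i)–(iii).  Whether c is
-- the i-th child of u is a statement about the suffixes of u and c alone (c extends
-- u by one letter y, and i is the index of y), which gives (iv).  Finally u ∈ U
-- exactly when the children of u extend it by *, so the last letter of any child of u
-- records whether u is skipped; Φ preserves it, which gives (v).
module Submission where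

open import Defs
open import Data.Nat using (ℕ; suc; _≤_; _<_)
import Data.Nat as ℕ
open import Data.Nat.Properties using (≤-refl; ≤-trans; ≤-antisym; n≤1+n; <-irrefl; <⇒≤)
open import Data.Fin using (Fin; toℕ; fromℕ<)
import Data.Fin.Properties as Fin
open import Data.Maybe using (just; nothing; is-nothing)
import Data.Maybe.Properties as Maybe
open import Data.Bool using (true; false)
import Data.Bool.Properties as Bool
open import Data.Empty using (⊥-elim)
open import Data.Product using (Σ; _×_; _,_; proj₁; proj₂; map; map₁; map₂; uncurry)
open import Data.Product.Properties using (,-injectiveˡ)
open import Data.Product.Properties.WithK using (,-injectiveʳ)
open import Relation.Nullary using (¬_; yes; no)
open import Relation.Nullary.Decidable using (Dec; map′; recompute)
open import Relation.Binary.Definitions using (DecidableEquality)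
open import Relation.Binary.PropositionalEquality
  using (_≡_; refl; sym; trans; cong; subst₂; module ≡-Reasoning)
open import Function.Bundles using (_⇔_; mk⇔)
import Function.Properties.Equivalence as ⇔
open import Function.Definitions using (Bijective)

module StringProperties (m : ℕ → ℕ) where
  open Strings m

  Str⇒≤ : ∀ {j l} → Str j l → j ≤ l
  Str⇒≤ ε       = ≤-refl
  Str⇒≤ (a ▷ _) = ≤-trans (Str⇒≤ a) (n≤1+n _)

  ¬Str[1+l,l] : ∀ {l} → ¬ Str (suc l) l
  ¬Str[1+l,l] a = <-irrefl refl (Str⇒≤ a)

  Str[l,l]≡ε : ∀ {l} (a : Str l l) → a ≡ ε
  Str[l,l]≡ε ε       = refl
  Str[l,l]≡ε (a ▷ _) = ⊥-elim (¬Str[1+l,l] a)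

  ▷-injectiveˡ : ∀ {j l} {a b : Str j l} {x y : Ans l} → a ▷ x ≡ b ▷ y → a ≡ b
  ▷-injectiveˡ refl = refl

  ▷-injectiveʳ : ∀ {j l} {a b : Str j l} {x y : Ans l} → a ▷ x ≡ b ▷ y → x ≡ y
  ▷-injectiveʳ refl = refl

  _≟_ : ∀ {j l} → DecidableEquality (Str j l)
  ε       ≟ b       rewrite Str[l,l]≡ε b = yes refl
  (a ▷ x) ≟ ε       = ⊥-elim (¬Str[1+l,l] a)
  (a ▷ x) ≟ (b ▷ y) with a ≟ b | Maybe.≡-dec Fin._≟_ x y
  ... | yes refl | yes refl = yes refl
  ... | no a≢b   | _        = no (λ e → a≢b (▷-injectiveˡ e))
  ... | yes _    | no x≢y   = no (λ e → x≢y (▷-injectiveʳ e))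

  ++-cancelˡ : ∀ {j k l} (b : Str j k) {x z : Str k l} → (b ++ x) ≡ (b ++ z) → x ≡ z
  ++-cancelˡ b {ε}     {z}     e = sym (Str[l,l]≡ε z)
  ++-cancelˡ b {x ▷ _} {ε}     e = ⊥-elim (¬Str[1+l,l] x)
  ++-cancelˡ b {x ▷ _} {z ▷ _} e
    with refl ← ++-cancelˡ b (▷-injectiveˡ e) | refl ← ▷-injectiveʳ e = refl

  ++-cancelˡ-Σ : ∀ {j k p q} (b : Str j k) {x : Str k p} {z : Str k q} →
                 (p , b ++ x) ≡ (q , b ++ z) → _≡_ {A = Σ ℕ (Str k)} (p , x) (q , z)
  ++-cancelˡ-Σ b e with refl ← ,-injectiveˡ e = cong (_ ,_) (++-cancelˡ b (,-injectiveʳ e))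

  suffix? : ∀ {j k l} (b : Str j k) (a : Str j l) → Dec (Σ (Str k l) λ x → a ≡ (b ++ x))
  suffix? {k = k} {l} b a with k ℕ.≟ l
  ... | yes refl = map′ (ε ,_) (λ (x , e) → trans e (cong (b ++_) (Str[l,l]≡ε x))) (a ≟ b)
  suffix? b ε       | no k≢l = no (λ (x , _) → k≢l (≤-antisym (Str⇒≤ x) (Str⇒≤ b)))
  suffix? {k = k} b (a ▷ y) | no k≢l = map′ (map (_▷ y) (cong (_▷ y))) shorten (suffix? b a)
    where
    shorten : Σ (Str k _) (λ x → a ▷ y ≡ (b ++ x)) → Σ (Str k _) λ x → a ≡ (b ++ x)
    shorten (ε     , _) = ⊥-elim (k≢l refl)
    shorten (x ▷ _ , e) = x , ▷-injectiveˡ e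

  index : ∀ {l} → Ans l → ℕ
  index nothing  = 0
  index (just j) = toℕ j

  IsExtension : ∀ {j} → Σ ℕ (Str j) → ℕ → Σ ℕ (Str j) → Set
  IsExtension (p , a) i c = Σ (Ans p) λ y → c ≡ (suc p , a ▷ y) × i ≡ index y

  ++-IsExtension⇔ : ∀ {j k p q i} (b : Str j k) {x : Str k p} {z : Str k q} →
                    IsExtension (p , b ++ x) i (q , b ++ z) ⇔ IsExtension (p , x) i (q , z)
  ++-IsExtension⇔ b = mk⇔ (map₂ (map₁ (++-cancelˡ-Σ b))) (map₂ (map₁ (cong (map₂ (b ++_)))))

module FSTreeProperties (Q : Questionnaire) (SL : SkipList Q) where
  open Questionnaire Q
  open Strings m
  open SkipList SL
  open FSTree Q SL
  open StringProperties m

  point : ∀ {q} → Vert q → Σ ℕ (Str 0)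
  point {q} u = q , α u

  position : ∀ {k} {v : Vert k} → Sub v → Σ ℕ (Str 0)
  position u = point (vx u)

  position-injective : ∀ {k} {v : Vert k} {s t : Sub v} → position s ≡ position t → s ≡ t
  position-injective {s = sub _ (vert _ _) _} {sub _ (vert _ _) _} refl = refl

  IsV⇒S : ∀ {p a y} → IsV (suc p) (a ▷ y) → S p a ≡ is-nothing y
  IsV⇒S (skipV _ _ s)  = s
  IsV⇒S (ansV _ _ s _) = s

  S-at-parent : ∀ {p q a y} (c : Vert q) → point c ≡ (suc p , a ▷ y) → S p a ≡ is-nothing y
  S-at-parent {p} {a = a} {y} (vert _ isV) refl = recompute (S p a Bool.≟ is-nothing y) (IsV⇒S isV)

  ChildAt⇔IsExtension : ∀ {p q i} {u : Vert p} {c : Vert q} →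
                        ChildAt u i c ⇔ IsExtension (point u) i (point c)
  ChildAt⇔IsExtension {u = u} {c} = mk⇔ to from
    where
    to : ∀ {i} → ChildAt u i c → IsExtension (point u) i (point c)
    to (skipC _ e)  = nothing , cong (_ ,_) e , refl
    to (ansC j _ e) = just j , cong (_ ,_) e , refl

    from : ∀ {i} → IsExtension (point u) i (point c) → ChildAt u i c
    from (nothing , e , refl) with refl ← e = skipC (S-at-parent c e) refl
    from (just j  , e , refl) with refl ← e = ansC j (S-at-parent c e) refl

  ChildAt⇔IsExtension-suffix : ∀ {k p q p′ q′ i} {u : Vert p′} {c : Vert q′}
    (b : Str 0 k) {x : Str k p} {z : Str k q} → point u ≡ (p , b ++ x) → point c ≡ (q , b ++ z) →
    ChildAt u i c ⇔ IsExtension (p , x) i (q , z)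
  ChildAt⇔IsExtension-suffix {i = i} {u} {c} b eu ec =
    ⇔.trans (subst₂ (λ s t → ChildAt u i c ⇔ IsExtension s i t) eu ec ChildAt⇔IsExtension)
            (++-IsExtension⇔ b)

  hasChild : ∀ {q} (u : Vert q) → q < N → 1 ≤ m q →
             Σ (Ans q) λ y → Σ (Vert (suc q)) λ c → α c ≡ α u ▷ y × ChildAt u (index y) c
  hasChild {q} (vert a isV) q<N 1≤m with S q a in s
  ... | true  = nothing , vert (a ▷ nothing) (skipV isV q<N s) , refl , skipC s refl
  ... | false = just j , vert (a ▷ just j) (ansV isV q<N s j) , refl , ansC j s refl
    where
    j : Fin (m q)
    j = fromℕ< 1≤m

  Desc⇒suffix : ∀ {k l} {v : Vert k} {u : Vert l} → Desc v u → Σ (Str k l) λ x → α u ≡ (α v ++ x)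
  Desc⇒suffix here                  = ε , refl
  Desc⇒suffix (step d (skipC _ e))  =
    map (_▷ nothing) (λ e′ → trans e (cong (_▷ nothing) e′)) (Desc⇒suffix d)
  Desc⇒suffix (step d (ansC j _ e)) =
    map (_▷ just j) (λ e′ → trans e (cong (_▷ just j) e′)) (Desc⇒suffix d)

  -- The descent proof in a subtree vertex is irrelevant, so the suffix is recovered
  -- from it through the decision procedure suffix?.
  suffix : ∀ {k} {v : Vert k} (u : Sub v) → Str k (κ u)
  suffix {v = v} (sub _ u d) = proj₁ (recompute (suffix? (α v) (α u)) (Desc⇒suffix d))

  α-suffix : ∀ {k} {v : Vert k} (u : Sub v) → α (vx u) ≡ (α v ++ suffix u)
  α-suffix {v = v} (sub _ u d) = proj₂ (recompute (suffix? (α v) (α u)) (Desc⇒suffix d))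

  position-suffix : ∀ {k} {v : Vert k} (u : Sub v) → position u ≡ (κ u , α v ++ suffix u)
  position-suffix u = cong (κ u ,_) (α-suffix u)

  subtreeChild : ∀ {k} {v : Vert k} (u : Sub v) → κ u < N → 1 ≤ m (κ u) →
                 Σ (Ans (κ u)) λ y → Σ (Sub v) λ c → position c ≡ (suc (κ u) , α (vx u) ▷ y)
  subtreeChild (sub q u d) q<N 1≤m with y , c , e , ch ← hasChild u q<N 1≤m =
    y , sub (suc q) c (step d ch) , cong (suc q ,_) e

  module _ {k} {v w : Vert k} (Φ : Sub v → Sub w) (Φ-prop : StrProp v w Φ) where

    StrProp⇒position : ∀ u → position (Φ u) ≡ (κ u , α w ++ suffix u)
    StrProp⇒position u = Φ-prop u (suffix u) (α-suffix u)

    StrProp⇒position-++ : ∀ {p} (u : Sub v) {x : Str k p} →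
                          position u ≡ (p , α v ++ x) → position (Φ u) ≡ (p , α w ++ x)
    StrProp⇒position-++ u e =
      trans (StrProp⇒position u)
            (cong (map₂ (α w ++_)) (++-cancelˡ-Σ (α v) (trans (sym (position-suffix u)) e)))

    StrProp⇒top : Φ (top v) ≡ top w
    StrProp⇒top = position-injective (Φ-prop (top v) ε refl)

    StrProp⇒κ : ∀ u → κ (Φ u) ≡ κ u
    StrProp⇒κ u = cong proj₁ (StrProp⇒position u)

    StrProp⇒ChildAt⇔ : ∀ (u c : Sub v) i → ChildAt (vx u) i (vx c) ⇔ ChildAt (vx (Φ u)) i (vx (Φ c))
    StrProp⇒ChildAt⇔ u c i =
      ⇔.trans (ChildAt⇔IsExtension-suffix (α v) (position-suffix u) (position-suffix c))
              (⇔.sym (ChildAt⇔IsExtension-suffix (α w) (StrProp⇒position u) (StrProp⇒position c)))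

    StrProp⇒S : ∀ u → κ u < N → 1 ≤ m (κ u) → S (κ (Φ u)) (α (vx (Φ u))) ≡ S (κ u) (α (vx u))
    StrProp⇒S u q<N 1≤m with y , c , c-position ← subtreeChild u q<N 1≤m = begin
      S (κ (Φ u)) (α (vx (Φ u)))   ≡⟨ cong (uncurry S) (StrProp⇒position u) ⟩
      S (κ u) (α w ++ suffix u)    ≡⟨ S-at-parent (vx (Φ c)) (StrProp⇒position-++ c c-suffix) ⟩
      is-nothing y                 ≡⟨ S-at-parent (vx c) c-position ⟨
      S (κ u) (α (vx u))           ∎
      where
      open ≡-Reasoning
      c-suffix : position c ≡ (suc (κ u) , α v ++ (suffix u ▷ y))
      c-suffix = trans c-position (cong (λ a → suc (κ u) , a ▷ y) (α-suffix u))

    StrProp⇒Skipped⇔ : ∀ u → κ u < N → 1 ≤ m (κ u) → Skipped (vx u) ⇔ Skipped (vx (Φ u))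
    StrProp⇒Skipped⇔ u q<N 1≤m =
      mk⇔ (trans (StrProp⇒S u q<N 1≤m)) (trans (sym (StrProp⇒S u q<N 1≤m)))

  StrProp-unique : ∀ {k} {v w : Vert k} (Φ Ψ : Sub v → Sub w) →
                   StrProp v w Φ → StrProp v w Ψ → ∀ u → Ψ u ≡ Φ u
  StrProp-unique Φ Ψ Φ-prop Ψ-prop u =
    position-injective (trans (StrProp⇒position Ψ Ψ-prop u) (sym (StrProp⇒position Φ Φ-prop u)))

lemma4p12 : (Q : Questionnaire) (F : FlagSet Q) (SL : SkipList Q) →
    let open Questionnaire Q
        open FSTree Q SL
    in ∀ {k} (v w : Vert k) (Φ : Sub v → Sub w) →
       Bijective _≡_ _≡_ Φ → StrProp v w Φ →
       (Φ (top v) ≡ top w)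
       × (∀ u → κ (Φ u) ≡ κ u)
       × (∀ (Ψ : Sub v → Sub w) → Bijective _≡_ _≡_ Ψ → StrProp v w Ψ →
            ∀ u → Ψ u ≡ Φ u)
       × IsOrdIso v w Φ
       × (∀ u → κ u < N → 2 ≤ m (κ u) →
            Skipped (vx u) ⇔ Skipped (vx (Φ u)))
lemma4p12 Q _ SL v w Φ Φ-bij Φ-prop =
    StrProp⇒top Φ Φ-prop
  , StrProp⇒κ Φ Φ-prop
  , (λ Ψ _ Ψ-prop → StrProp-unique Φ Ψ Φ-prop Ψ-prop)
  , (Φ-bij , StrProp⇒top Φ Φ-prop , StrProp⇒ChildAt⇔ Φ Φ-prop)
  , λ u q<N 2≤m → StrProp⇒Skipped⇔ Φ Φ-prop u q<N (<⇒≤ 2≤m)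
  where
  open FSTree Q SL
  open FSTreeProperties Q SL
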